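{- Let $G$ be a graph on $n$ vertices $v_1,\dots,v_n$ such that for some integers $a_2,\dots,a_n\ge2$ we have $d_G(t,a_2,\dots,a_n)=\alpha t-\beta$ with $\gcd(\alpha,\beta)=1$. Let $G^+$ be the graph obtained by attaching a new vertex $v_0$ to $v_1$ with $e\ge1$ edges (with $v_0$ ordered first). Let $q\ge1$ be any integer coprime to $e\alpha\beta$. Then $d_{G^+}(q,t,a_2,\dots,a_n)$ is of the form $\alpha' t-\beta'$ with $\gcd(\alpha',\beta')=1$.
   Context: Graphs have no self-loops but may have multiple edges. For a graph $H$ with vertices $w_1,\dots,w_m$ and adjacency matrix $A_H$ ($(i,j)$ entry = number of edges between $w_i,w_j$), $d_H(x_1,\dots,x_m)=\det(\mathrm{Diag}(x_1,\dots,x_m)-A_H)$, the $i$-th variable corresponding to the $i$-th vertex. -}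

module Defs where

open import Data.Nat using (ℕ; zero; suc)
open import Data.Fin using (Fin; zero; suc; punchIn; toℕ)
open import Data.Fin.Properties using (_≟_)
open import Data.Integer using (ℤ; +_; _+_; _-_; _*_; -_; 0ℤ; 1ℤ)
open import Relation.Nullary using (does)
open import Data.Bool using (if_then_else_)
open import Relation.Binary.PropositionalEquality using (_≡_)

Matrix : ℕ → Set
Matrix n = Fin n → Fin n → ℤ

sgn : ℕ → ℤ
sgn zero = 1ℤ
sgn (suc k) = - sgn k

Σ : (n : ℕ) → (Fin n → ℤ) → ℤ
Σ zero f = 0ℤ
Σ (suc n) f = f zero + Σ n (λ j → f (suc j))

det : (n : ℕ) → Matrix n → ℤ
det zero M = 1ℤ
det (suc n) M =
  Σ (suc n) (λ j → sgn (toℕ j) * (M zero j * det n (λ r c → M (suc r) (punchIn j c))))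

-- A graph (multiple edges allowed, no self-loops) on vertices Fin n,
-- given by its adjacency matrix (entry = number of edges).
record Graph (n : ℕ) : Set where
  field
    adj      : Fin n → Fin n → ℕ
    symmetric : ∀ i j → adj i j ≡ adj j i
    loopless  : ∀ i → adj i i ≡ 0
open Graph public

charMatrix : {n : ℕ} → Graph n → (Fin n → ℤ) → Matrix n
charMatrix {n} H x i j =
  (if does (i ≟ j) then x i else 0ℤ) - + adj H i j

d : {n : ℕ} → Graph n → (Fin n → ℤ) → ℤ
d {n} H x = det n (charMatrix H x)

_◁_ : {m : ℕ} → ℤ → (Fin m → ℤ) → Fin (suc m) → ℤ
(t ◁ a) zero = t
(t ◁ a) (suc i) = a i
infixr 5 _◁_

-- G⁺: new vertex v₀ (index zero) joined to v₁ (index 1) by e edges;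
-- old vertex i becomes suc i.
-- number of edges from the new vertex v₀ to the old vertex j
toNew : {m : ℕ} → ℕ → Fin (suc m) → ℕ
toNew e zero = e
toNew e (suc j) = 0

plusAdj : {m : ℕ} → Graph (suc m) → ℕ → Fin (suc (suc m)) → Fin (suc (suc m)) → ℕ
plusAdj G e zero zero = 0
plusAdj G e zero (suc j) = toNew e j
plusAdj G e (suc i) zero = toNew e i
plusAdj G e (suc i) (suc j) = adj G i j

plusSym : {m : ℕ} (G : Graph (suc m)) (e : ℕ) → ∀ i j → plusAdj G e i j ≡ plusAdj G e j i
plusSym G e zero zero = _≡_.refl
plusSym G e zero (suc j) = _≡_.refl
plusSym G e (suc i) zero = _≡_.refl
plusSym G e (suc i) (suc j) = symmetric G i j

plusLoop : {m : ℕ} (G : Graph (suc m)) (e : ℕ) → ∀ i → plusAdj G e i i ≡ 0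
plusLoop G e zero = _≡_.refl
plusLoop G e (suc i) = loopless G i

attach : {m : ℕ} → Graph (suc m) → ℕ → Graph (suc (suc m))
attach G e = record { adj = plusAdj G e ; symmetric = plusSym G e ; loopless = plusLoop G e }

{-# OPTIONS --safe #-}
-- Expanding d_{G⁺} along the row of v₀, whose only entries are q and −e, gives
-- d_{G⁺}(q, t, a) = q·d_G(t, a) − e²·d_{G−v₁}(a). The coefficient of t in d_G(t, a) is
-- d_{G−v₁}(a), so d_{G−v₁}(a) = α and d_{G⁺}(q, t, a) = qα·t − (qβ + e²α). Finally q is
-- coprime to e²α and α is coprime to qβ, so both are coprime to qβ + e²α; the coprimality
-- bookkeeping is done with Bézout coefficients.
module Submission where

open import Defs
open import Data.Nat using (ℕ; suc)
open import Data.Fin using (Fin)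
open import Data.Integer using (ℤ; +_; _-_; _*_; _≤_)
open import Data.Integer.Coprimality using (Coprime)
open import Data.Product using (Σ-syntax; _×_)
open import Relation.Binary.PropositionalEquality using (_≡_)

import Data.Nat as ℕ
open import Data.Fin using (zero; suc; punchIn; toℕ)
open import Data.Integer using (_+_; -_; 0ℤ; 1ℤ; -1ℤ; ∣_∣; -[1+_])
open import Data.Integer.Properties using (*-zeroˡ; *-zeroʳ; *-identityˡ; *-assoc; +-comm; +-identityʳ; -1*i≡-i; pos-+; pos-*)
open import Data.Integer.Tactic.RingSolver using (solve-∀)
import Data.Integer.Divisibility.Signed as ℤ∣
open import Data.Nat.Coprimality using (coprime-Bézout)
open import Data.Nat.GCD using (module Bézout)
open import Data.Nat.Divisibility using (∣1⇒≡1)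
open import Data.Product using (∃; ∃₂; _,_)
open import Relation.Binary.PropositionalEquality using (refl; sym; trans; cong; cong₂; subst; module ≡-Reasoning)

minor : {n : ℕ} → Matrix (suc n) → Fin (suc n) → Matrix n
minor M j r c = M (suc r) (punchIn j c)

cofactorTerm : {n : ℕ} → Matrix (suc n) → Fin (suc n) → ℤ
cofactorTerm {n} M j = sgn (toℕ j) * (M zero j * det n (minor M j))

Σ-zero : ∀ n (f : Fin n → ℤ) → (∀ j → f j ≡ 0ℤ) → Σ n f ≡ 0ℤ
Σ-zero ℕ.zero    f f≡0 = refl
Σ-zero (ℕ.suc n) f f≡0 = cong₂ _+_ (f≡0 zero) (Σ-zero n (λ j → f (suc j)) (λ j → f≡0 (suc j)))

cofactorTerm-entry≡0 : ∀ {n} (M : Matrix (suc n)) j → M zero j ≡ 0ℤ → cofactorTerm M j ≡ 0ℤ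
cofactorTerm-entry≡0 {n} M j M₀ⱼ≡0 = begin
  sgn (toℕ j) * (M zero j * det n (minor M j)) ≡⟨ cong (λ x → sgn (toℕ j) * (x * det n (minor M j))) M₀ⱼ≡0 ⟩
  sgn (toℕ j) * (0ℤ * det n (minor M j))       ≡⟨ cong (sgn (toℕ j) *_) (*-zeroˡ (det n (minor M j))) ⟩
  sgn (toℕ j) * 0ℤ                             ≡⟨ *-zeroʳ (sgn (toℕ j)) ⟩
  0ℤ                                           ∎
  where open ≡-Reasoning

cofactorTerm-minor≡0 : ∀ {n} (M : Matrix (suc n)) j → det n (minor M j) ≡ 0ℤ → cofactorTerm M j ≡ 0ℤ
cofactorTerm-minor≡0 M j minor≡0 =
  trans (cong (λ x → sgn (toℕ j) * (M zero j * x)) minor≡0)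
        (trans (cong (sgn (toℕ j) *_) (*-zeroʳ (M zero j))) (*-zeroʳ (sgn (toℕ j))))

mutual
  det-zeroFirstColumn : ∀ n (M : Matrix (suc n)) → (∀ r → M r zero ≡ 0ℤ) → det (suc n) M ≡ 0ℤ
  det-zeroFirstColumn n M col≡0 = begin
    det (suc n) M                        ≡⟨ det-firstColumn n M (λ r → col≡0 (suc r)) ⟩
    M zero zero * det n (minor M zero)   ≡⟨ cong (_* det n (minor M zero)) (col≡0 zero) ⟩
    0ℤ * det n (minor M zero)            ≡⟨ *-zeroˡ (det n (minor M zero)) ⟩
    0ℤ                                   ∎
    where open ≡-Reasoning

  det-firstColumn : ∀ n (M : Matrix (suc n)) → (∀ r → M (suc r) zero ≡ 0ℤ) →
    det (suc n) M ≡ M zero zero * det n (minor M zero)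
  det-firstColumn n M col≡0 = begin
    cofactorTerm M zero + Σ n (λ j → cofactorTerm M (suc j))
      ≡⟨ cong (λ s → cofactorTerm M zero + s) (Σ-zero n _ (λ j → cofactorTerm-minor≡0 M (suc j) (det-minor-suc≡0 M j col≡0))) ⟩
    cofactorTerm M zero + 0ℤ
      ≡⟨ +-identityʳ (cofactorTerm M zero) ⟩
    1ℤ * (M zero zero * det n (minor M zero))
      ≡⟨ *-identityˡ (M zero zero * det n (minor M zero)) ⟩
    M zero zero * det n (minor M zero) ∎
    where open ≡-Reasoning

  det-minor-suc≡0 : ∀ {n} (M : Matrix (suc n)) (j : Fin n) → (∀ r → M (suc r) zero ≡ 0ℤ) →
    det n (minor M (suc j)) ≡ 0ℤ
  det-minor-suc≡0 {suc n} M j col≡0 = det-zeroFirstColumn n (minor M (suc j)) col≡0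

det-twoEntryFirstRow : ∀ n (M : Matrix (suc (suc n))) → (∀ j → M zero (suc (suc j)) ≡ 0ℤ) →
  det (suc (suc n)) M ≡
    M zero zero * det (suc n) (minor M zero) - M zero (suc zero) * det (suc n) (minor M (suc zero))
det-twoEntryFirstRow n M row≡0 = begin
  cofactorTerm M zero + (cofactorTerm M (suc zero) + Σ n (λ j → cofactorTerm M (suc (suc j))))
    ≡⟨ cong (λ s → cofactorTerm M zero + (cofactorTerm M (suc zero) + s))
            (Σ-zero n _ (λ j → cofactorTerm-entry≡0 M (suc (suc j)) (row≡0 j))) ⟩
  1ℤ * x + (-1ℤ * y + 0ℤ)
    ≡⟨ signs x y ⟩
  x - y ∎
  where
    open ≡-Reasoning
    x = M zero zero * det (suc n) (minor M zero)
    y = M zero (suc zero) * det (suc n) (minor M (suc zero))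
    signs : ∀ x y → 1ℤ * x + (-1ℤ * y + 0ℤ) ≡ x - y
    signs = solve-∀

deleteFirst : {m : ℕ} → Graph (suc m) → Graph m
deleteFirst G = record
  { adj       = λ i j → adj G (suc i) (suc j)
  ; symmetric = λ i j → symmetric G (suc i) (suc j)
  ; loopless  = λ i → loopless G (suc i)
  }

d-affineInFirst : ∀ {m} (G : Graph (suc m)) (a : Fin m → ℤ) →
  ∃ λ K → ∀ t → d G (t ◁ a) ≡ t * d (deleteFirst G) a + K
d-affineInFirst {m} G a = K , expand
  where
    K : ℤ
    K = Σ m (λ j → cofactorTerm (charMatrix G (0ℤ ◁ a)) (suc j))
    expand : ∀ t → d G (t ◁ a) ≡ t * d (deleteFirst G) a + K
    expand t rewrite loopless G zero = unit t (d (deleteFirst G) a) K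
      where
        unit : ∀ t D K → 1ℤ * ((t - 0ℤ) * D) + K ≡ t * D + K
        unit = solve-∀

affine-coefficient-unique : ∀ {D K α β : ℤ} → (∀ t → t * D + K ≡ α * t - β) → D ≡ α
affine-coefficient-unique {D} {K} {α} {β} eq = begin
  D                                 ≡⟨ difference D K ⟩
  (1ℤ * D + K) - (0ℤ * D + K)       ≡⟨ cong₂ _-_ (eq 1ℤ) (eq 0ℤ) ⟩
  (α * 1ℤ - β) - (α * 0ℤ - β)       ≡⟨ difference′ α β ⟩
  α                                 ∎
  where
    open ≡-Reasoning
    difference : ∀ D K → D ≡ (1ℤ * D + K) - (0ℤ * D + K)
    difference = solve-∀
    difference′ : ∀ α β → (α * 1ℤ - β) - (α * 0ℤ - β) ≡ α
    difference′ = solve-∀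

d-deleteFirst≡leadingCoefficient : ∀ {m} (G : Graph (suc m)) (a : Fin m → ℤ) {α β : ℤ} →
  (∀ t → d G (t ◁ a) ≡ α * t - β) → d (deleteFirst G) a ≡ α
d-deleteFirst≡leadingCoefficient G a eq with d-affineInFirst G a
... | K , expand = affine-coefficient-unique (λ t → trans (sym (expand t)) (eq t))

d-attach : ∀ {m} (G : Graph (suc m)) (e : ℕ) (a : Fin m → ℤ) (q t : ℤ) →
  d (attach G e) (q ◁ t ◁ a) ≡ q * d G (t ◁ a) - + e * + e * d (deleteFirst G) a
d-attach {m} G e a q t = begin
  d (attach G e) (q ◁ t ◁ a)
    ≡⟨ det-twoEntryFirstRow m P (λ j → refl) ⟩
  (q - 0ℤ) * d G (t ◁ a) - (0ℤ - + e) * det (suc m) (minor P (suc zero))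
    ≡⟨ cong (λ x → (q - 0ℤ) * d G (t ◁ a) - (0ℤ - + e) * x) (det-firstColumn m (minor P (suc zero)) (λ r → refl)) ⟩
  (q - 0ℤ) * d G (t ◁ a) - (0ℤ - + e) * ((0ℤ - + e) * d (deleteFirst G) a)
    ≡⟨ simplify q (d G (t ◁ a)) (+ e) (d (deleteFirst G) a) ⟩
  q * d G (t ◁ a) - + e * + e * d (deleteFirst G) a ∎
  where
    open ≡-Reasoning
    P : Matrix (suc (suc m))
    P = charMatrix (attach G e) (q ◁ t ◁ a)
    simplify : ∀ q D E D′ → (q - 0ℤ) * D - (0ℤ - E) * ((0ℤ - E) * D′) ≡ q * D - E * E * D′
    simplify = solve-∀

Bézout : ℤ → ℤ → Set
Bézout a b = ∃₂ λ x y → x * a + y * b ≡ 1ℤ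

Bézout-sym : ∀ {a b} → Bézout a b → Bézout b a
Bézout-sym {a} {b} (x , y , eq) = y , x , trans (+-comm (y * b) (x * a)) eq

Bézout-*ˡ : ∀ {a b c} → Bézout a c → Bézout b c → Bézout (a * b) c
Bézout-*ˡ {a} {b} {c} (x , y , eq) (x′ , y′ , eq′) =
  x * x′ , x * a * y′ + y * x′ * b + y * y′ * c ,
  trans (sym (product x a y c x′ b y′)) (cong₂ _*_ eq eq′)
  where
    product : ∀ x a y c x′ b y′ → (x * a + y * c) * (x′ * b + y′ * c) ≡
      x * x′ * (a * b) + (x * a * y′ + y * x′ * b + y * y′ * c) * c
    product = solve-∀

Bézout-factorˡ : ∀ {a b c} → Bézout a (b * c) → Bézout a b
Bézout-factorˡ {a} {b} {c} (x , y , eq) = x , y * c , trans (regroup x a y b c) eq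
  where
    regroup : ∀ x a y b c → x * a + y * c * b ≡ x * a + y * (b * c)
    regroup = solve-∀

Bézout-factorʳ : ∀ {a b c} → Bézout a (b * c) → Bézout a c
Bézout-factorʳ {a} {b} {c} (x , y , eq) = x , y * b , trans (regroup x a y b c) eq
  where
    regroup : ∀ x a y b c → x * a + y * b * c ≡ x * a + y * (b * c)
    regroup = solve-∀

Bézout-+-*ˡ : ∀ {a b} k → Bézout a b → Bézout a (a * k + b)
Bézout-+-*ˡ {a} {b} k (x , y , eq) = x - y * k , y , trans (shift x a y b k) eq
  where
    shift : ∀ x a y b k → (x - y * k) * a + y * (a * k + b) ≡ x * a + y * b
    shift = solve-∀

Bézout-+-*ʳ : ∀ {a b} k → Bézout a b → Bézout a (b + k * a)
Bézout-+-*ʳ {a} {b} k (x , y , eq) = x - y * k , y , trans (shift x a y b k) eq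
  where
    shift : ∀ x a y b k → (x - y * k) * a + y * (b + k * a) ≡ x * a + y * b
    shift = solve-∀

ℕ-Bézout⇒Bézout : ∀ {m n} → Bézout.Identity 1 m n → Bézout (+ m) (+ n)
ℕ-Bézout⇒Bézout {m} {n} (Bézout.+- x y eq) = + x , - + y , (begin
  + x * + m + - + y * + n           ≡⟨ negate (+ x) (+ m) (+ y) (+ n) ⟩
  + x * + m - + y * + n             ≡⟨ cong₂ _-_ (sym (pos-* x m)) (sym (pos-* y n)) ⟩
  + (x ℕ.* m) - + (y ℕ.* n)         ≡⟨ cong (λ z → + z - + (y ℕ.* n)) (sym eq) ⟩
  + (1 ℕ.+ y ℕ.* n) - + (y ℕ.* n)   ≡⟨ cong (_- + (y ℕ.* n)) (pos-+ 1 (y ℕ.* n)) ⟩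
  1ℤ + + (y ℕ.* n) - + (y ℕ.* n)    ≡⟨ cancel (+ (y ℕ.* n)) ⟩
  1ℤ                                ∎)
  where
    open ≡-Reasoning
    negate : ∀ a b c d → a * b + - c * d ≡ a * b - c * d
    negate = solve-∀
    cancel : ∀ z → 1ℤ + z - z ≡ 1ℤ
    cancel = solve-∀
ℕ-Bézout⇒Bézout (Bézout.-+ x y eq) = Bézout-sym (ℕ-Bézout⇒Bézout (Bézout.+- y x eq))

sign-multiple : ∀ a → ∃ λ s → s * a ≡ + ∣ a ∣
sign-multiple (+ n)    = 1ℤ , *-identityˡ (+ n)
sign-multiple -[1+ n ] = -1ℤ , -1*i≡-i -[1+ n ]

Bézout-abs : ∀ {a b} → Bézout (+ ∣ a ∣) (+ ∣ b ∣) → Bézout a b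
Bézout-abs {a} {b} (x , y , eq) with sign-multiple a | sign-multiple b
... | s , sa≡∣a∣ | s′ , s′b≡∣b∣ = x * s , y * s′ ,
  trans (cong₂ _+_ (trans (*-assoc x s a) (cong (x *_) sa≡∣a∣))
                   (trans (*-assoc y s′ b) (cong (y *_) s′b≡∣b∣))) eq

coprime⇒Bézout : ∀ {a b} → Coprime a b → Bézout a b
coprime⇒Bézout c = Bézout-abs (ℕ-Bézout⇒Bézout (coprime-Bézout c))

Bézout⇒coprime : ∀ {a b} → Bézout a b → Coprime a b
Bézout⇒coprime {a} {b} (x , y , eq) {k} (k∣a , k∣b) = ∣1⇒≡1 (ℤ∣.∣⇒∣ᵤ k∣1)
  where
    k∣1 : + k ℤ∣.∣ 1ℤ
    k∣1 = subst (+ k ℤ∣.∣_) eq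
      (ℤ∣.∣m∣n⇒∣m+n (ℤ∣.∣n⇒∣m*n x (ℤ∣.∣ᵤ⇒∣ k∣a)) (ℤ∣.∣n⇒∣m*n y (ℤ∣.∣ᵤ⇒∣ k∣b)))

coprime-attachedCoefficients : ∀ {q E α β} → Coprime q (E * α * β) → Coprime α β →
  Coprime (q * α) (q * β + E * E * α)
coprime-attachedCoefficients {q} {E} {α} {β} q⊥Eαβ α⊥β =
  Bézout⇒coprime (Bézout-*ˡ q⊥β′ α⊥β′)
  where
    q⊥Eα : Bézout q (E * α)
    q⊥Eα = Bézout-factorˡ (coprime⇒Bézout {q} {E * α * β} q⊥Eαβ)
    E⊥q : Bézout E q
    E⊥q = Bézout-sym (Bézout-factorˡ {c = α} q⊥Eα)
    α⊥q : Bézout α q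
    α⊥q = Bézout-sym (Bézout-factorʳ {b = E} q⊥Eα)
    q⊥β′ : Bézout q (q * β + E * E * α)
    q⊥β′ = Bézout-+-*ˡ β (Bézout-sym (Bézout-*ˡ (Bézout-*ˡ E⊥q E⊥q) α⊥q))
    α⊥β′ : Bézout α (q * β + E * E * α)
    α⊥β′ = Bézout-+-*ʳ (E * E) (Bézout-sym (Bézout-*ˡ (Bézout-sym α⊥q) (Bézout-sym (coprime⇒Bézout {α} {β} α⊥β))))

lemma4p5 : (m : ℕ) (G : Graph (suc m)) (a : Fin m → ℤ) → (∀ i → + 2 ≤ a i) →
    (α β : ℤ) → (∀ t → d G (t ◁ a) ≡ α * t - β) → Coprime α β →
    (e : ℕ) → 1 Data.Nat.≤ e → (q : ℤ) → + 1 ≤ q → Coprime q (+ e * α * β) →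
    Σ[ α′ ∈ ℤ ] Σ[ β′ ∈ ℤ ]
      ((∀ t → d (attach G e) (q ◁ t ◁ a) ≡ α′ * t - β′) × Coprime α′ β′)
lemma4p5 m G a _ α β d≡αt-β α⊥β e _ q _ q⊥eαβ =
  q * α , q * β + + e * + e * α , d⁺≡α′t-β′ , coprime-attachedCoefficients {q} {+ e} q⊥eαβ α⊥β
  where
    d⁺≡α′t-β′ : ∀ t → d (attach G e) (q ◁ t ◁ a) ≡ q * α * t - (q * β + + e * + e * α)
    d⁺≡α′t-β′ t = begin
      d (attach G e) (q ◁ t ◁ a)                          ≡⟨ d-attach G e a q t ⟩
      q * d G (t ◁ a) - + e * + e * d (deleteFirst G) a   ≡⟨ cong₂ (λ x y → q * x - + e * + e * y)
                                                               (d≡αt-β t) (d-deleteFirst≡leadingCoefficient G a d≡αt-β) ⟩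
      q * (α * t - β) - + e * + e * α                     ≡⟨ collect q α β t (+ e) ⟩
      q * α * t - (q * β + + e * + e * α)                 ∎
      where
        open ≡-Reasoning
        collect : ∀ q α β t E → q * (α * t - β) - E * E * α ≡ q * α * t - (q * β + E * E * α)
        collect = solve-∀
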